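{- For the hard-core model at activity $\lambda=3.4$, WSM does not hold for the tree $T_{\boldsymbol{D}_G}$.
   Context: Hard-core model on a finite graph at activity $\lambda>0$: distribution on independent sets $I$ with $\mu(I)\propto\lambda^{|I|}$; $p_v(\tau)$ is the probability that $v$ is unoccupied conditioned on a configuration $\tau$ on a set of vertices. For an infinite locally finite rooted tree $T$ with root $r$, $T_L$ is the subtree induced by vertices at depth $\le L$; WSM holds for $T$ at $\lambda$ if there is $\gamma\in(0,1)$ such that for all $L$ and all configurations $\tau_1,\tau_2$ on the depth-$L$ vertices of $T_L$, $|p_r(\tau_1)-p_r(\tau_2)|\le\gamma^L$ (computed in $T_L$). $T_{\boldsymbol{D}_G}$ is the rooted tree of walks in $\mathbb{Z}^2$ from the origin with steps $N=(0,1),E=(1,0),W=(-1,0)$ generated by the rules (the last letter of a state is the step just taken; each listed state gives one child): $O\to N|E|W$ (root), $N\to NN|NE|NW$, $W\to WN|WW$, $E\to EN|EE$, $NN\to NN|NE|NW$, $NW\to WN|WW$, $NE\to EN|EE$, $WW\to WN|WW$, $EE\to EN|EE$, $WN\to NW|NN$, $EN\to NE|NN$.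
   Formalization: The decay rate γ in the definition of WSM ranges over the rationals in (0,1). -}

module Defs where

open import Data.Nat using (ℕ; zero; suc)
open import Data.Bool using (Bool; true; false; _∧_; _∨_; not; if_then_else_)
open import Data.List using (List; []; _∷_; _++_; map; concatMap; foldr)
open import Data.Product using (_×_; _,_; Σ; ∃)
open import Data.Unit using (⊤; tt)
open import Data.Integer using (+_)
open import Data.Rational using (ℚ; 0ℚ; 1ℚ; _+_; _*_; _-_; _÷_; _≤_; _<_; ∣_∣; ≢-nonZero)
open import Data.Rational.Properties using (_≟_)
open import Relation.Nullary using (yes; no)

data Tree : Set where
  node : List Tree → Tree

-- The tree T_{D_G}: states of the generating rules and their children.

data State : Set where
  O N E W NN NE NW WW EE WN EN : State

children : State → List State
children O  = N ∷ E ∷ W ∷ []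
children N  = NN ∷ NE ∷ NW ∷ []
children W  = WN ∷ WW ∷ []
children E  = EN ∷ EE ∷ []
children NN = NN ∷ NE ∷ NW ∷ []
children NW = WN ∷ WW ∷ []
children NE = EN ∷ EE ∷ []
children WW = WN ∷ WW ∷ []
children EE = EN ∷ EE ∷ []
children WN = NW ∷ NN ∷ []
children EN = NE ∷ NN ∷ []

mutual
  grow : ℕ → State → Tree
  grow zero    s = node []
  grow (suc L) s = node (growAll L (children s))

  growAll : ℕ → List State → List Tree
  growAll L []       = []
  growAll L (s ∷ ss) = grow L s ∷ growAll L ss

T-DG : ℕ → Tree
T-DG L = grow L O

-- Configurations: an occupation bit (true = occupied) for every vertex.

mutual
  Config : Tree → Set
  Config (node ts) = Bool × Configs ts

  Configs : List Tree → Set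
  Configs []       = ⊤
  Configs (t ∷ ts) = Config t × Configs ts

mutual
  Boundary : ℕ → Tree → Set
  Boundary zero    (node ts) = Bool
  Boundary (suc L) (node ts) = Boundaries L ts

  Boundaries : ℕ → List Tree → Set
  Boundaries L []       = ⊤
  Boundaries L (t ∷ ts) = Boundary L t × Boundaries L ts

mutual
  restrict : (L : ℕ) (t : Tree) → Config t → Boundary L t
  restrict zero    (node ts) (b , cs) = b
  restrict (suc L) (node ts) (b , cs) = restrictAll L ts cs

  restrictAll : (L : ℕ) (ts : List Tree) → Configs ts → Boundaries L ts
  restrictAll L []       tt       = tt
  restrictAll L (t ∷ ts) (c , cs) = restrict L t c , restrictAll L ts cs

mutual
  eqB : (L : ℕ) (t : Tree) → Boundary L t → Boundary L t → Bool
  eqB zero    (node ts) b b' = (b ∧ b') ∨ (not b ∧ not b')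
  eqB (suc L) (node ts) x y  = eqBs L ts x y

  eqBs : (L : ℕ) (ts : List Tree) → Boundaries L ts → Boundaries L ts → Bool
  eqBs L []       tt       tt         = true
  eqBs L (t ∷ ts) (x , xs) (y , ys) = eqB L t x y ∧ eqBs L ts xs ys

mutual
  allConfigs : (t : Tree) → List (Config t)
  allConfigs (node ts) =
    concatMap (λ b → map (λ cs → (b , cs)) (allConfigss ts)) (true ∷ false ∷ [])

  allConfigss : (ts : List Tree) → List (Configs ts)
  allConfigss []       = tt ∷ []
  allConfigss (t ∷ ts) =
    concatMap (λ c → map (λ cs → (c , cs)) (allConfigss ts)) (allConfigs t)

rootBit : (t : Tree) → Config t → Bool
rootBit (node ts) (b , cs) = b

mutual
  independent : (t : Tree) → Config t → Bool
  independent (node ts) (b , cs) = indepChildren b ts cs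

  indepChildren : Bool → (ts : List Tree) → Configs ts → Bool
  indepChildren b []       tt       = true
  indepChildren b (t ∷ ts) (c , cs) =
    not (b ∧ rootBit t c) ∧ independent t c ∧ indepChildren b ts cs

_^ℚ_ : ℚ → ℕ → ℚ
x ^ℚ zero  = 1ℚ
x ^ℚ suc n = x * (x ^ℚ n)

-- total division (returns 0 when dividing by 0; never used at 0 below)
_/ℚ_ : ℚ → ℚ → ℚ
p /ℚ q with q ≟ 0ℚ
... | yes _  = 0ℚ
... | no q≢0 = _÷_ p q {{≢-nonZero q≢0}}

mutual
  size : (t : Tree) → Config t → ℕ
  size (node ts) (b , cs) = (if b then 1 else 0) Data.Nat.+ sizes ts cs

  sizes : (ts : List Tree) → Configs ts → ℕ
  sizes []       tt       = 0
  sizes (t ∷ ts) (c , cs) = size t c Data.Nat.+ sizes ts cs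

weight : ℚ → (t : Tree) → Config t → ℚ
weight λ' t c = if independent t c then λ' ^ℚ size t c else 0ℚ

sumW : ℚ → (t : Tree) → (Config t → Bool) → ℚ
sumW λ' t P = foldr (λ c acc → (if P c then weight λ' t c else 0ℚ) + acc) 0ℚ (allConfigs t)

pRoot : ℚ → (L : ℕ) (t : Tree) → Boundary L t → ℚ
pRoot λ' L t τ =
  sumW λ' t (λ c → eqB L t (restrict L t c) τ ∧ not (rootBit t c))
  /ℚ sumW λ' t (λ c → eqB L t (restrict L t c) τ)

WSM-DG : ℚ → Set
WSM-DG λ' = Σ ℚ λ γ → (0ℚ < γ) × (γ < 1ℚ) ×
  ((L : ℕ) (τ₁ τ₂ : Boundary L (T-DG L)) →
     ∣ pRoot λ' L (T-DG L) τ₁ - pRoot λ' L (T-DG L) τ₂ ∣ ≤ γ ^ℚ L)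

-- With the boundary of T_L all occupied or all free, the probability that a
-- vertex is free is a ratio of partition functions, and it obeys the tree
-- recursion p(v) = 1 / (1 + λ ∏ p(children)).  At λ = 3.4 explicit rational
-- bounds lo, hi per state (checked by computation) show that this recursion
-- sends values ≤ lo to values ≥ hi and back, so at every depth L the two
-- boundaries put the root probability on opposite sides of [lo O, hi O].
-- The gap hi O - lo O > 0 persists, whereas WSM forces it below γ ^ L → 0.
module Submission where

open import Algebra.Bundles using (Ring)
open import Data.Bool using (Bool; true; false; _∧_; not; if_then_else_; T)
open import Data.Bool.Properties using (∧-identityʳ; ∧-zeroʳ)
open import Data.Integer as ℤ using (+_; +[1+_])
import Data.Integer.Properties as ℤ
open import Data.List using (List; []; _∷_; _++_; map; concatMap; foldr)
open import Data.Nat as ℕ using (ℕ; zero; suc)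
import Data.Nat.Properties as ℕ
open import Data.Nat.Coprimality using (Coprime)
open import Data.Product using (_×_; _,_; ∃; proj₁; proj₂)
open import Data.Rational
  using (ℚ; mkℚ; *<*; _≤ᵇ_; 0ℚ; 1ℚ; _+_; _*_; _-_; -_; _/_; _≤_; _<_; ∣_∣; toℚᵘ; positive; nonNegative; ≢-nonZero)
open import Data.Rational.Properties
open import Data.Rational.Unnormalised as ℚᵘ using (mkℚᵘ; _≃_)
import Data.Rational.Unnormalised.Properties as ℚᵘ
open import Data.Sum using (_⊎_; inj₁; inj₂)
open import Data.Unit using (tt)
open import Relation.Binary.PropositionalEquality
open import Relation.Nullary using (¬_; yes; no; contradiction)
open import Relation.Nullary.Decidable using (toWitness)
open import Algebra.Properties.Semiring.Mult (Ring.semiring +-*-ring) using (×-comm-*)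
  renaming (_×_ to _·_)
open import Data.Rational.Solver using (module +-*-Solver)
open +-*-Solver using (solve; _:+_; _:*_; :-_; _:=_; con)

open import Defs

nonNeg-*-monoˡ-≤ : ∀ {r p q} → 0ℚ ≤ r → p ≤ q → r * p ≤ r * q
nonNeg-*-monoˡ-≤ {r} 0≤r = *-monoˡ-≤-nonNeg r {{nonNegative 0≤r}}

nonNeg-*-monoʳ-≤ : ∀ {r p q} → 0ℚ ≤ r → p ≤ q → p * r ≤ q * r
nonNeg-*-monoʳ-≤ {r} 0≤r = *-monoʳ-≤-nonNeg r {{nonNegative 0≤r}}

nonNeg-*-mono-≤ : ∀ {a b c d} → 0ℚ ≤ a → 0ℚ ≤ d → a ≤ b → c ≤ d → a * c ≤ b * d
nonNeg-*-mono-≤ 0≤a 0≤d a≤b c≤d =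
  ≤-trans (nonNeg-*-monoˡ-≤ 0≤a c≤d) (nonNeg-*-monoʳ-≤ 0≤d a≤b)

*-nonNeg : ∀ {p q} → 0ℚ ≤ p → 0ℚ ≤ q → 0ℚ ≤ p * q
*-nonNeg {p} 0≤p 0≤q = subst (_≤ p * _) (*-zeroʳ p) (nonNeg-*-monoˡ-≤ 0≤p 0≤q)

*-pos : ∀ {p q} → 0ℚ < p → 0ℚ < q → 0ℚ < p * q
*-pos {p} 0<p 0<q = subst (_< p * _) (*-zeroʳ p) (*-monoʳ-<-pos p {{positive 0<p}} 0<q)

0<1 : 0ℚ < 1ℚ
0<1 = positive⁻¹ 1ℚ

p<q⇒0<q-p : ∀ {p q} → p < q → 0ℚ < q - p
p<q⇒0<q-p {p} {q} p<q = subst (_< q - p) (+-inverseʳ p) (+-monoˡ-< (- p) p<q)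

p≤∣p∣ : ∀ p → p ≤ ∣ p ∣
p≤∣p∣ p with ≤-total 0ℚ p
... | inj₁ 0≤p = ≤-reflexive (sym (0≤p⇒∣p∣≡p 0≤p))
... | inj₂ p≤0 = ≤-trans p≤0 (0≤∣p∣ p)

∣p-q∣≡∣q-p∣ : ∀ p q → ∣ p - q ∣ ≡ ∣ q - p ∣
∣p-q∣≡∣q-p∣ p q = begin
  ∣ p - q ∣      ≡⟨ ∣-p∣≡∣p∣ (p - q) ⟨
  ∣ - (p - q) ∣  ≡⟨ cong ∣_∣ (solve 2 (λ p q → :- (p :+ (:- q)) := q :+ (:- p)) refl p q) ⟩
  ∣ q - p ∣      ∎
  where open ≡-Reasoning

separated⇒gap≤∣-∣ : ∀ {a b l h} → a ≤ l → h ≤ b → h - l ≤ ∣ b - a ∣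
separated⇒gap≤∣-∣ {a} {b} a≤l h≤b =
  ≤-trans (+-mono-≤ h≤b (neg-antimono-≤ a≤l)) (p≤∣p∣ (b - a))

private variable A B : Set

∑ : List A → (A → ℚ) → ℚ
∑ xs f = foldr (λ x acc → f x + acc) 0ℚ xs

∏ : List ℚ → ℚ
∏ = foldr _*_ 1ℚ

∑-cong : (xs : List A) {f g : A → ℚ} → (∀ x → f x ≡ g x) → ∑ xs f ≡ ∑ xs g
∑-cong []       f≗g = refl
∑-cong (x ∷ xs) f≗g = cong₂ _+_ (f≗g x) (∑-cong xs f≗g)

∑-zero : (xs : List A) → ∑ xs (λ _ → 0ℚ) ≡ 0ℚ
∑-zero []       = refl
∑-zero (x ∷ xs) = trans (+-identityˡ _) (∑-zero xs)

∑-++ : (xs ys : List A) (f : A → ℚ) → ∑ (xs ++ ys) f ≡ ∑ xs f + ∑ ys f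
∑-++ []       ys f = sym (+-identityˡ _)
∑-++ (x ∷ xs) ys f = trans (cong (λ s → f x + s) (∑-++ xs ys f)) (sym (+-assoc (f x) _ _))

∑-map : (h : A → B) (xs : List A) (f : B → ℚ) → ∑ (map h xs) f ≡ ∑ xs (λ x → f (h x))
∑-map h []       f = refl
∑-map h (x ∷ xs) f = cong (λ s → f (h x) + s) (∑-map h xs f)

∑-*ˡ : (k : ℚ) (xs : List A) (f : A → ℚ) → ∑ xs (λ x → k * f x) ≡ k * ∑ xs f
∑-*ˡ k []       f = sym (*-zeroʳ k)
∑-*ˡ k (x ∷ xs) f = trans (cong (λ s → k * f x + s) (∑-*ˡ k xs f)) (sym (*-distribˡ-+ k (f x) _))

∑-*ʳ : (k : ℚ) (xs : List A) (f : A → ℚ) → ∑ xs (λ x → f x * k) ≡ ∑ xs f * k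
∑-*ʳ k []       f = sym (*-zeroˡ k)
∑-*ʳ k (x ∷ xs) f = trans (cong (λ s → f x * k + s) (∑-*ʳ k xs f)) (sym (*-distribʳ-+ k (f x) _))

∑-pairs : (xs : List A) (ys : List B) (h : A × B → ℚ) →
          ∑ (concatMap (λ x → map (x ,_) ys) xs) h ≡ ∑ xs (λ x → ∑ ys (λ y → h (x , y)))
∑-pairs []       ys h = refl
∑-pairs (x ∷ xs) ys h = begin
  ∑ (map (x ,_) ys ++ concatMap (λ x → map (x ,_) ys) xs) h
    ≡⟨ ∑-++ (map (x ,_) ys) _ h ⟩
  ∑ (map (x ,_) ys) h + ∑ (concatMap (λ x → map (x ,_) ys) xs) h
    ≡⟨ cong₂ _+_ (∑-map (x ,_) ys h) (∑-pairs xs ys h) ⟩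
  ∑ ys (λ y → h (x , y)) + ∑ xs (λ x → ∑ ys (λ y → h (x , y)))  ∎
  where open ≡-Reasoning

∑-pairs-* : (xs : List A) (ys : List B) (f : A → ℚ) (g : B → ℚ) →
            ∑ (concatMap (λ x → map (x ,_) ys) xs) (λ p → f (proj₁ p) * g (proj₂ p))
            ≡ ∑ xs f * ∑ ys g
∑-pairs-* xs ys f g = begin
  ∑ (concatMap (λ x → map (x ,_) ys) xs) (λ p → f (proj₁ p) * g (proj₂ p))
    ≡⟨ ∑-pairs xs ys (λ p → f (proj₁ p) * g (proj₂ p)) ⟩
  ∑ xs (λ x → ∑ ys (λ y → f x * g y))  ≡⟨ ∑-cong xs (λ x → ∑-*ˡ (f x) ys g) ⟩
  ∑ xs (λ x → f x * ∑ ys g)            ≡⟨ ∑-*ʳ (∑ ys g) xs f ⟩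
  ∑ xs f * ∑ ys g                      ∎
  where open ≡-Reasoning

∏-map-* : (f g : A → ℚ) (xs : List A) →
          ∏ (map (λ x → f x * g x) xs) ≡ ∏ (map f xs) * ∏ (map g xs)
∏-map-* f g []       = refl
∏-map-* f g (x ∷ xs) = begin
  (f x * g x) * ∏ (map (λ x → f x * g x) xs)      ≡⟨ cong (f x * g x *_) (∏-map-* f g xs) ⟩
  (f x * g x) * (∏ (map f xs) * ∏ (map g xs))
    ≡⟨ solve 4 (λ a b c d → (a :* b) :* (c :* d) := (a :* c) :* (b :* d)) refl (f x) (g x) _ _ ⟩
  (f x * ∏ (map f xs)) * (g x * ∏ (map g xs))     ∎
  where open ≡-Reasoning

∏-nonNeg : {f : A → ℚ} → (∀ x → 0ℚ ≤ f x) → ∀ xs → 0ℚ ≤ ∏ (map f xs)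
∏-nonNeg 0≤f []       = <⇒≤ 0<1
∏-nonNeg 0≤f (x ∷ xs) = *-nonNeg (0≤f x) (∏-nonNeg 0≤f xs)

∏-pos : {f : A → ℚ} → (∀ x → 0ℚ < f x) → ∀ xs → 0ℚ < ∏ (map f xs)
∏-pos 0<f []       = 0<1
∏-pos 0<f (x ∷ xs) = *-pos (0<f x) (∏-pos 0<f xs)

∏-mono-≤ : {f g : A → ℚ} → (∀ x → 0ℚ ≤ f x) → (∀ x → f x ≤ g x) →
           ∀ xs → ∏ (map f xs) ≤ ∏ (map g xs)
∏-mono-≤ 0≤f f≤g []       = ≤-refl
∏-mono-≤ 0≤f f≤g (x ∷ xs) =
  nonNeg-*-mono-≤ (0≤f x) (∏-nonNeg (λ y → ≤-trans (0≤f y) (f≤g y)) xs)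
                  (f≤g x) (∏-mono-≤ 0≤f f≤g xs)

^ℚ-distribˡ-+-* : ∀ p m n → p ^ℚ (m ℕ.+ n) ≡ p ^ℚ m * p ^ℚ n
^ℚ-distribˡ-+-* p zero    n = sym (*-identityˡ _)
^ℚ-distribˡ-+-* p (suc m) n =
  trans (cong (p *_) (^ℚ-distribˡ-+-* p m n)) (sym (*-assoc p _ _))

^ℚ-nonNeg : ∀ {p} → 0ℚ ≤ p → ∀ n → 0ℚ ≤ p ^ℚ n
^ℚ-nonNeg 0≤p zero    = <⇒≤ 0<1
^ℚ-nonNeg 0≤p (suc n) = *-nonNeg 0≤p (^ℚ-nonNeg 0≤p n)

·-nonNeg : ∀ {p} → 0ℚ ≤ p → ∀ n → 0ℚ ≤ n · p
·-nonNeg 0≤p zero    = ≤-refl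
·-nonNeg 0≤p (suc n) = +-mono-≤ 0≤p (·-nonNeg 0≤p n)

bernoulli : ∀ {γ} → 0ℚ ≤ γ → γ ≤ 1ℚ → ∀ n → γ ^ℚ n * (1ℚ + n · (1ℚ - γ)) ≤ 1ℚ
bernoulli {γ} 0≤γ γ≤1 zero    = ≤-refl
bernoulli {γ} 0≤γ γ≤1 (suc n) = begin
  (γ * γ ^ℚ n) * (1ℚ + (d + X))  ≡⟨ solve 3 (λ g p Y → (g :* p) :* Y := p :* (g :* Y)) refl γ (γ ^ℚ n) _ ⟩
  γ ^ℚ n * (γ * (1ℚ + (d + X)))  ≤⟨ nonNeg-*-monoˡ-≤ (^ℚ-nonNeg 0≤γ n) γ[1+d+X]≤1+X ⟩
  γ ^ℚ n * (1ℚ + X)              ≤⟨ bernoulli 0≤γ γ≤1 n ⟩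
  1ℚ                             ∎
  where
    open ≤-Reasoning
    d = 1ℚ - γ
    X = n · d
    0≤d : 0ℚ ≤ d
    0≤d = subst (_≤ d) (+-inverseʳ γ) (+-monoˡ-≤ (- γ) γ≤1)
    γ[1+d+X]≤1+X : γ * (1ℚ + (d + X)) ≤ 1ℚ + X
    γ[1+d+X]≤1+X = begin
      γ * (1ℚ + (d + X))                        ≡⟨ +-identityʳ _ ⟨
      γ * (1ℚ + (d + X)) + 0ℚ
        ≤⟨ +-monoʳ-≤ (γ * (1ℚ + (d + X))) (+-mono-≤ (*-nonNeg 0≤d (·-nonNeg 0≤d n)) (*-nonNeg 0≤d 0≤d)) ⟩
      γ * (1ℚ + (d + X)) + (d * X + d * d)
        ≡⟨ solve 2 (λ g Y → let d = con 1ℚ :+ (:- g) in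
                              g :* (con 1ℚ :+ (d :+ Y)) :+ (d :* Y :+ d :* d) := con 1ℚ :+ Y) refl γ X ⟩
      1ℚ + X                                    ∎

toℚᵘ-· : ∀ n {a b} .{c : Coprime a (suc b)} → toℚᵘ (n · mkℚ (+ a) b c) ≃ mkℚᵘ (+ (n ℕ.* a)) b
toℚᵘ-· zero          = ℚᵘ.*≡* refl
toℚᵘ-· (suc n) {a} {b} {c} = ℚᵘ.≃-trans (toℚᵘ-homo-+ (mkℚ (+ a) b c) (n · mkℚ (+ a) b c))
  (ℚᵘ.≃-trans (ℚᵘ.+-congʳ (mkℚᵘ (+ a) b) (toℚᵘ-· n)) (ℚᵘ.*≡* (begin
    (+ a ℤ.* + suc b ℤ.+ + (n ℕ.* a) ℤ.* + suc b) ℤ.* + suc b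
      ≡⟨ cong (ℤ._* + suc b) (ℤ.*-distribʳ-+ (+ suc b) (+ a) (+ (n ℕ.* a))) ⟨
    ((+ a ℤ.+ + (n ℕ.* a)) ℤ.* + suc b) ℤ.* + suc b
      ≡⟨ ℤ.*-assoc (+ a ℤ.+ + (n ℕ.* a)) (+ suc b) (+ suc b) ⟩
    (+ a ℤ.+ + (n ℕ.* a)) ℤ.* (+ suc b ℤ.* + suc b)
      ≡⟨ cong₂ ℤ._*_ (ℤ.pos-+ a (n ℕ.* a)) (ℤ.pos-* (suc b) (suc b)) ⟨
    + (suc n ℕ.* a) ℤ.* + (suc b ℕ.* suc b)  ∎)))
  where open ≡-Reasoning

-- Taking n to be the denominator of q makes n · q its numerator.
archimedean : ∀ {q} → 0ℚ < q → ∃ λ n → 1ℚ ≤ n · q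
archimedean {mkℚ +[1+ a ] b _} _ = suc b ,
  toℚᵘ-cancel-≤ (ℚᵘ.≤-respʳ-≃ (ℚᵘ.≃-sym (toℚᵘ-· (suc b))) (ℚᵘ.*≤* 1·d≤n·1))
  where
    1·d≤n·1 : + 1 ℤ.* + suc b ℤ.≤ + (suc b ℕ.* suc a) ℤ.* + 1
    1·d≤n·1 = subst₂ ℤ._≤_ (sym (ℤ.*-identityˡ _)) (sym (ℤ.*-identityʳ _))
                     (ℤ.+≤+ (ℕ.m≤m*n (suc b) (suc a)))
archimedean {mkℚ (+ 0)       _ _} (*<* (ℤ.+<+ ()))
archimedean {mkℚ ℤ.-[1+ _ ]  _ _} (*<* ())

^ℚ-eventually-< : ∀ {γ δ} → 0ℚ ≤ γ → γ < 1ℚ → 0ℚ < δ → ∃ λ n → γ ^ℚ n < δ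
^ℚ-eventually-< {γ} {δ} 0≤γ γ<1 0<δ = n , ≰⇒> δ≰γⁿ
  where
    0<d = p<q⇒0<q-p γ<1
    large = archimedean (*-pos 0<δ 0<d)
    n = proj₁ large
    X = n · (1ℚ - γ)
    1≤δX : 1ℚ ≤ δ * X
    1≤δX = subst (1ℚ ≤_) (sym (×-comm-* n δ (1ℚ - γ))) (proj₂ large)
    δ≰γⁿ : ¬ δ ≤ γ ^ℚ n
    δ≰γⁿ δ≤γⁿ = <-irrefl refl (<-≤-trans (+-monoˡ-< 1ℚ 0<δ) (begin
      δ + 1ℚ          ≤⟨ +-monoʳ-≤ δ 1≤δX ⟩
      δ + δ * X       ≡⟨ solve 2 (λ a Y → a :+ a :* Y := a :* (con 1ℚ :+ Y)) refl δ X ⟩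
      δ * (1ℚ + X)    ≤⟨ nonNeg-*-monoʳ-≤ (+-mono-≤ (<⇒≤ 0<1) (·-nonNeg (<⇒≤ 0<d) n)) δ≤γⁿ ⟩
      γ ^ℚ n * (1ℚ + X) ≤⟨ bernoulli 0≤γ (<⇒≤ γ<1) n ⟩
      1ℚ              ∎))
      where open ≤-Reasoning

-- Partition functions of the hard-core model on a tree

if-*ˡ : ∀ b k x → (if b then k * x else 0ℚ) ≡ k * (if b then x else 0ℚ)
if-*ˡ true  k x = refl
if-*ˡ false k x = sym (*-zeroʳ k)

if-∧-true : ∀ b (x : ℚ) → (if b ∧ true then x else 0ℚ) ≡ (if b then x else 0ℚ)
if-∧-true b x = cong (λ e → if e then x else 0ℚ) (∧-identityʳ b)

module _ (λ' : ℚ) where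

  -- The weight of c when it agrees with τ at depth L and, if b = true, leaves
  -- the root free as an occupied parent of t would force; otherwise 0.
  weightGiven : (L : ℕ) (t : Tree) → Boundary L t → Bool → Config t → ℚ
  weightGiven L t τ b c =
    if eqB L t (restrict L t c) τ ∧ not (b ∧ rootBit t c) then weight λ' t c else 0ℚ

  Z : (L : ℕ) (t : Tree) → Boundary L t → Bool → ℚ
  Z L t τ b = ∑ (allConfigs t) (weightGiven L t τ b)

  Zs : (L : ℕ) (ts : List Tree) → Boundaries L ts → Bool → ℚ
  Zs L []       tt       b = 1ℚ
  Zs L (t ∷ ts) (τ , τs) b = Z L t τ b * Zs L ts τs b

  forestWeightGiven : (L : ℕ) (ts : List Tree) → Boundaries L ts → Bool → Configs ts → ℚ
  forestWeightGiven L ts τs b cs =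
    if eqBs L ts (restrictAll L ts cs) τs
    then (if indepChildren b ts cs then λ' ^ℚ sizes ts cs else 0ℚ) else 0ℚ

  forestWeightGiven-∷ : ∀ L t ts τ τs b c cs →
    forestWeightGiven L (t ∷ ts) (τ , τs) b (c , cs)
    ≡ weightGiven L t τ b c * forestWeightGiven L ts τs b cs
  forestWeightGiven-∷ L t ts τ τs b c cs =
    factor (eqB L t (restrict L t c) τ) (eqBs L ts (restrictAll L ts cs) τs)
           (not (b ∧ rootBit t c)) (independent t c) (indepChildren b ts cs)
           (size t c) (sizes ts cs)
    where
      factor : ∀ e e′ f i i′ m n →
        (if e ∧ e′ then (if f ∧ i ∧ i′ then λ' ^ℚ (m ℕ.+ n) else 0ℚ) else 0ℚ)
        ≡ (if e ∧ f then (if i then λ' ^ℚ m else 0ℚ) else 0ℚ)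
          * (if e′ then (if i′ then λ' ^ℚ n else 0ℚ) else 0ℚ)
      factor false e′    f     i     i′    m n = sym (*-zeroˡ (if e′ then _ else 0ℚ))
      factor true  false f     i     i′    m n = sym (*-zeroʳ (if f then _ else 0ℚ))
      factor true  true  false i     i′    m n = sym (*-zeroˡ (if i′ then λ' ^ℚ n else 0ℚ))
      factor true  true  true  false i′    m n = sym (*-zeroˡ (if i′ then λ' ^ℚ n else 0ℚ))
      factor true  true  true  true  false m n = sym (*-zeroʳ (λ' ^ℚ m))
      factor true  true  true  true  true  m n = ^ℚ-distribˡ-+-* λ' m n

  ∑-forestWeightGiven : ∀ L ts τs b → ∑ (allConfigss ts) (forestWeightGiven L ts τs b) ≡ Zs L ts τs b
  ∑-forestWeightGiven L []       tt       b = refl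
  ∑-forestWeightGiven L (t ∷ ts) (τ , τs) b = begin
    ∑ (allConfigss (t ∷ ts)) (forestWeightGiven L (t ∷ ts) (τ , τs) b)
      ≡⟨ ∑-cong (allConfigss (t ∷ ts)) (λ p → forestWeightGiven-∷ L t ts τ τs b (proj₁ p) (proj₂ p)) ⟩
    ∑ (allConfigss (t ∷ ts)) (λ p → weightGiven L t τ b (proj₁ p) * forestWeightGiven L ts τs b (proj₂ p))
      ≡⟨ ∑-pairs-* (allConfigs t) (allConfigss ts) (weightGiven L t τ b) (forestWeightGiven L ts τs b) ⟩
    Z L t τ b * ∑ (allConfigss ts) (forestWeightGiven L ts τs b)
      ≡⟨ cong (Z L t τ b *_) (∑-forestWeightGiven L ts τs b) ⟩
    Z L t τ b * Zs L ts τs b  ∎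
    where open ≡-Reasoning

  module _ (L : ℕ) (ts : List Tree) (τ : Boundaries L ts) where

    private
      css = allConfigss ts

      free-root : ∀ b cs → weightGiven (suc L) (node ts) τ b (false , cs) ≡ forestWeightGiven L ts τ false cs
      free-root b cs = trans (cong (λ e → if agrees ∧ not e then _ else 0ℚ) (∧-zeroʳ b))
                             (if-∧-true agrees _)
        where agrees = eqBs L ts (restrictAll L ts cs) τ

      Z-node-split : ∀ b → Z (suc L) (node ts) τ b
        ≡ ∑ css (λ cs → weightGiven (suc L) (node ts) τ b (true , cs)) + Zs L ts τ false
      Z-node-split b = begin
        Z (suc L) (node ts) τ b
          ≡⟨ ∑-pairs (true ∷ false ∷ []) css (weightGiven (suc L) (node ts) τ b) ⟩
        ∑ css (λ cs → weightGiven (suc L) (node ts) τ b (true , cs))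
          + (∑ css (λ cs → weightGiven (suc L) (node ts) τ b (false , cs)) + 0ℚ)
          ≡⟨ cong (_+_ occupied) (+-identityʳ _) ⟩
        ∑ css (λ cs → weightGiven (suc L) (node ts) τ b (true , cs))
          + ∑ css (λ cs → weightGiven (suc L) (node ts) τ b (false , cs))
          ≡⟨ cong (_+_ occupied) (trans (∑-cong css (free-root b)) (∑-forestWeightGiven L ts τ false)) ⟩
        ∑ css (λ cs → weightGiven (suc L) (node ts) τ b (true , cs)) + Zs L ts τ false  ∎
        where
          open ≡-Reasoning
          occupied = ∑ css (λ cs → weightGiven (suc L) (node ts) τ b (true , cs))

    Z-node-parentOccupied : Z (suc L) (node ts) τ true ≡ Zs L ts τ false
    Z-node-parentOccupied = begin
      Z (suc L) (node ts) τ true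
        ≡⟨ Z-node-split true ⟩
      ∑ css (λ cs → weightGiven (suc L) (node ts) τ true (true , cs)) + Zs L ts τ false
        ≡⟨ cong (_+ Zs L ts τ false) (trans (∑-cong css occupied-root) (∑-zero css)) ⟩
      0ℚ + Zs L ts τ false
        ≡⟨ +-identityˡ _ ⟩
      Zs L ts τ false  ∎
      where
        open ≡-Reasoning
        occupied-root : ∀ cs → weightGiven (suc L) (node ts) τ true (true , cs) ≡ 0ℚ
        occupied-root cs = cong (λ e → if e then _ else 0ℚ) (∧-zeroʳ (eqBs L ts (restrictAll L ts cs) τ))

    Z-node-parentFree : Z (suc L) (node ts) τ false ≡ λ' * Zs L ts τ true + Zs L ts τ false
    Z-node-parentFree = begin
      Z (suc L) (node ts) τ false
        ≡⟨ Z-node-split false ⟩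
      ∑ css (λ cs → weightGiven (suc L) (node ts) τ false (true , cs)) + Zs L ts τ false
        ≡⟨ cong (_+ Zs L ts τ false) (trans (∑-cong css occupied-root) (∑-*ˡ λ' css _)) ⟩
      λ' * ∑ css (forestWeightGiven L ts τ true) + Zs L ts τ false
        ≡⟨ cong (λ z → λ' * z + Zs L ts τ false) (∑-forestWeightGiven L ts τ true) ⟩
      λ' * Zs L ts τ true + Zs L ts τ false  ∎
      where
        open ≡-Reasoning
        occupied-root : ∀ cs → weightGiven (suc L) (node ts) τ false (true , cs)
                               ≡ λ' * forestWeightGiven L ts τ true cs
        occupied-root cs = begin
          weightGiven (suc L) (node ts) τ false (true , cs)
            ≡⟨ if-∧-true e _ ⟩
          (if e then (if i then λ' * λ' ^ℚ sizes ts cs else 0ℚ) else 0ℚ)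
            ≡⟨ cong (λ z → if e then z else 0ℚ) (if-*ˡ i λ' _) ⟩
          (if e then λ' * (if i then λ' ^ℚ sizes ts cs else 0ℚ) else 0ℚ)
            ≡⟨ if-*ˡ e λ' _ ⟩
          λ' * forestWeightGiven L ts τ true cs  ∎
          where e = eqBs L ts (restrictAll L ts cs) τ
                i = indepChildren true ts cs

  pRoot≡Z/Z : ∀ L t τ → pRoot λ' L t τ ≡ Z L t τ true /ℚ Z L t τ false
  pRoot≡Z/Z L t τ = cong (Z L t τ true /ℚ_) (sym (∑-cong (allConfigs t) λ c →
    if-∧-true (eqB L t (restrict L t c) τ) (weight λ' t c)))

mutual
  uniform : Bool → (L : ℕ) (t : Tree) → Boundary L t
  uniform v zero    (node ts) = v
  uniform v (suc L) (node ts) = uniforms v L ts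

  uniforms : Bool → (L : ℕ) (ts : List Tree) → Boundaries L ts
  uniforms v L []       = tt
  uniforms v L (t ∷ ts) = uniform v L t , uniforms v L ts

module _ (λ' : ℚ) where

  ζ : ℕ → Bool → Bool → State → ℚ
  ζ zero    v true  s = if v then 0ℚ else 1ℚ
  ζ zero    v false s = if v then λ' else 1ℚ
  ζ (suc L) v true  s = ∏ (map (ζ L v false) (children s))
  ζ (suc L) v false s = λ' * ∏ (map (ζ L v true) (children s)) + ∏ (map (ζ L v false) (children s))

  Z-leaf : ∀ v b s → Z λ' zero (node []) v b ≡ ζ zero v b s
  Z-leaf true  true  s = refl
  Z-leaf true  false s = trans (+-identityʳ _) (*-identityʳ λ')
  Z-leaf false true  s = refl
  Z-leaf false false s = refl

  mutual
    Z-grow : ∀ L s v b → Z λ' L (grow L s) (uniform v L (grow L s)) b ≡ ζ L v b s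
    Z-grow zero    s v b     = Z-leaf v b s
    Z-grow (suc L) s v true  =
      trans (Z-node-parentOccupied λ' L (growAll L (children s)) _) (Zs-growAll L (children s) v false)
    Z-grow (suc L) s v false =
      trans (Z-node-parentFree λ' L (growAll L (children s)) _)
            (cong₂ (λ p q → λ' * p + q) (Zs-growAll L (children s) v true) (Zs-growAll L (children s) v false))

    Zs-growAll : ∀ L ss v b → Zs λ' L (growAll L ss) (uniforms v L (growAll L ss)) b ≡ ∏ (map (ζ L v b) ss)
    Zs-growAll L []       v b = refl
    Zs-growAll L (s ∷ ss) v b = cong₂ _*_ (Z-grow L s v b) (Zs-growAll L ss v b)

  pRoot-uniform : ∀ L v → pRoot λ' L (T-DG L) (uniform v L (T-DG L)) ≡ ζ L v true O /ℚ ζ L v false O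
  pRoot-uniform L v = trans (pRoot≡Z/Z λ' L (T-DG L) _) (cong₂ _/ℚ_ (Z-grow L O v true) (Z-grow L O v false))

  module _ (0<λ : 0ℚ < λ') where

    mutual
      ζ-free-nonNeg : ∀ L v s → 0ℚ ≤ ζ L v true s
      ζ-free-nonNeg zero    true  s = ≤-refl
      ζ-free-nonNeg zero    false s = <⇒≤ 0<1
      ζ-free-nonNeg (suc L) v     s = <⇒≤ (∏-pos (ζ-pos L v) (children s))

      ζ-pos : ∀ L v s → 0ℚ < ζ L v false s
      ζ-pos zero    true  s = 0<λ
      ζ-pos zero    false s = 0<1
      ζ-pos (suc L) v     s = +-mono-≤-<
        (*-nonNeg (<⇒≤ 0<λ) (∏-nonNeg (ζ-free-nonNeg L v) (children s)))
        (∏-pos (ζ-pos L v) (children s))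

-- Oscillation of the root probability

/ℚ-*-cancel : ∀ p {q} → 0ℚ < q → (p /ℚ q) * q ≡ p
/ℚ-*-cancel p {q} 0<q with q ≟ 0ℚ
... | yes q≡0 = contradiction (sym q≡0) (<⇒≢ 0<q)
... | no  q≢0 = trans (*-assoc p _ q) (trans (cong (p *_) (*-inverseˡ q {{≢-nonZero q≢0}})) (*-identityʳ p))

p≤c*q⇒p/q≤c : ∀ {p q c} → 0ℚ < q → p ≤ c * q → p /ℚ q ≤ c
p≤c*q⇒p/q≤c {p} {q} {c} 0<q p≤cq =
  *-cancelʳ-≤-pos q {{positive 0<q}} (subst (_≤ c * q) (sym (/ℚ-*-cancel p 0<q)) p≤cq)

c*q≤p⇒c≤p/q : ∀ {p q c} → 0ℚ < q → c * q ≤ p → c ≤ p /ℚ q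
c*q≤p⇒c≤p/q {p} {q} {c} 0<q cq≤p =
  *-cancelʳ-≤-pos q {{positive 0<q}} (subst (c * q ≤_) (sym (/ℚ-*-cancel p 0<q)) cq≤p)

above-step : ∀ {h a M P Q} → 0ℚ ≤ h → 0ℚ ≤ a → 0ℚ ≤ P →
             Q ≤ M * P → h * (1ℚ + a * M) ≤ 1ℚ → h * (a * Q + P) ≤ P
above-step {h} {a} {M} {P} {Q} 0≤h 0≤a 0≤P Q≤MP h[1+aM]≤1 = begin
  h * (a * Q + P)        ≤⟨ nonNeg-*-monoˡ-≤ 0≤h (+-monoˡ-≤ P (nonNeg-*-monoˡ-≤ 0≤a Q≤MP)) ⟩
  h * (a * (M * P) + P)
    ≡⟨ solve 4 (λ h a M P → h :* (a :* (M :* P) :+ P) := (h :* (con 1ℚ :+ a :* M)) :* P) refl h a M P ⟩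
  h * (1ℚ + a * M) * P   ≤⟨ nonNeg-*-monoʳ-≤ 0≤P h[1+aM]≤1 ⟩
  1ℚ * P                 ≡⟨ *-identityˡ P ⟩
  P                      ∎
  where open ≤-Reasoning

below-step : ∀ {l a M P Q} → 0ℚ ≤ l → 0ℚ ≤ a → 0ℚ ≤ P →
             M * P ≤ Q → 1ℚ ≤ l * (1ℚ + a * M) → P ≤ l * (a * Q + P)
below-step {l} {a} {M} {P} {Q} 0≤l 0≤a 0≤P MP≤Q 1≤l[1+aM] = begin
  P                      ≡⟨ *-identityˡ P ⟨
  1ℚ * P                 ≤⟨ nonNeg-*-monoʳ-≤ 0≤P 1≤l[1+aM] ⟩
  l * (1ℚ + a * M) * P
    ≡⟨ solve 4 (λ l a M P → (l :* (con 1ℚ :+ a :* M)) :* P := l :* (a :* (M :* P) :+ P)) refl l a M P ⟩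
  l * (a * (M * P) + P)  ≤⟨ nonNeg-*-monoˡ-≤ 0≤l (+-monoˡ-≤ P (nonNeg-*-monoˡ-≤ 0≤a MP≤Q)) ⟩
  l * (a * Q + P)        ∎
  where open ≤-Reasoning

-- lo and hi bracket a 2-cycle of p ↦ 1 / (1 + λ ∏ p(children)), where p s is
-- the probability that a vertex in state s is free: by hi-step and lo-step
-- the recursion maps values ≤ lo to values ≥ hi and values ≥ hi to values ≤ lo.
record Certificate (λ' : ℚ) : Set where
  field
    lo hi     : State → ℚ
    lo-nonNeg : ∀ s → 0ℚ ≤ lo s
    hi-nonNeg : ∀ s → 0ℚ ≤ hi s
    hi-step   : ∀ s → hi s * (1ℚ + λ' * ∏ (map lo (children s))) ≤ 1ℚ
    lo-step   : ∀ s → 1ℚ ≤ lo s * (1ℚ + λ' * ∏ (map hi (children s)))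

module Oscillation {λ' : ℚ} (0<λ : 0ℚ < λ') (C : Certificate λ') where

  open Certificate C

  0≤λ : 0ℚ ≤ λ'
  0≤λ = <⇒≤ 0<λ

  Below Above : ℕ → Bool → Set
  Below L v = ∀ s → ζ λ' L v true s ≤ lo s * ζ λ' L v false s
  Above L v = ∀ s → hi s * ζ λ' L v false s ≤ ζ λ' L v true s

  ζ-nonNeg : ∀ L v s → 0ℚ ≤ ζ λ' L v false s
  ζ-nonNeg L v s = <⇒≤ (ζ-pos λ' 0<λ L v s)

  below⇒above : ∀ L v → Below L v → Above (suc L) v
  below⇒above L v below s = above-step (hi-nonNeg s) 0≤λ (∏-nonNeg (ζ-nonNeg L v) cs) Q≤MP (hi-step s)
    where
      open ≤-Reasoning
      cs = children s
      Q≤MP : ∏ (map (ζ λ' L v true) cs) ≤ ∏ (map lo cs) * ∏ (map (ζ λ' L v false) cs)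
      Q≤MP = begin
        ∏ (map (ζ λ' L v true) cs)                       ≤⟨ ∏-mono-≤ (ζ-free-nonNeg λ' 0<λ L v) below cs ⟩
        ∏ (map (λ c → lo c * ζ λ' L v false c) cs)       ≡⟨ ∏-map-* lo (ζ λ' L v false) cs ⟩
        ∏ (map lo cs) * ∏ (map (ζ λ' L v false) cs)      ∎

  above⇒below : ∀ L v → Above L v → Below (suc L) v
  above⇒below L v above s = below-step (lo-nonNeg s) 0≤λ (∏-nonNeg (ζ-nonNeg L v) cs) MP≤Q (lo-step s)
    where
      open ≤-Reasoning
      cs = children s
      MP≤Q : ∏ (map hi cs) * ∏ (map (ζ λ' L v false) cs) ≤ ∏ (map (ζ λ' L v true) cs)
      MP≤Q = begin
        ∏ (map hi cs) * ∏ (map (ζ λ' L v false) cs)      ≡⟨ ∏-map-* hi (ζ λ' L v false) cs ⟨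
        ∏ (map (λ c → hi c * ζ λ' L v false c) cs)       ≤⟨ ∏-mono-≤ (λ c → *-nonNeg (hi-nonNeg c) (ζ-nonNeg L v c)) above cs ⟩
        ∏ (map (ζ λ' L v true) cs)                       ∎

  hi≤1 : ∀ s → hi s ≤ 1ℚ
  hi≤1 s = begin
    hi s                                        ≡⟨ *-identityʳ (hi s) ⟨
    hi s * 1ℚ                                   ≤⟨ nonNeg-*-monoˡ-≤ (hi-nonNeg s) 1≤1+λM ⟩
    hi s * (1ℚ + λ' * ∏ (map lo (children s)))  ≤⟨ hi-step s ⟩
    1ℚ                                          ∎
    where
      open ≤-Reasoning
      1≤1+λM : 1ℚ ≤ 1ℚ + λ' * ∏ (map lo (children s))
      1≤1+λM = subst (_≤ 1ℚ + λ' * ∏ (map lo (children s))) (+-identityʳ 1ℚ)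
        (+-monoʳ-≤ 1ℚ (*-nonNeg 0≤λ (∏-nonNeg lo-nonNeg (children s))))

  oscillation : ∀ L → (Below L true × Above L false) ⊎ (Above L true × Below L false)
  oscillation zero    = inj₁ ( (λ s → *-nonNeg (lo-nonNeg s) 0≤λ)
                             , (λ s → ≤-trans (≤-reflexive (*-identityʳ (hi s))) (hi≤1 s)) )
  oscillation (suc L) with oscillation L
  ... | inj₁ (below , above) = inj₂ (below⇒above L true below , above⇒below L false above)
  ... | inj₂ (above , below) = inj₁ (above⇒below L true above , below⇒above L false below)

  below⇒pRoot≤lo : ∀ L v → Below L v → pRoot λ' L (T-DG L) (uniform v L (T-DG L)) ≤ lo O
  below⇒pRoot≤lo L v below = subst (_≤ lo O) (sym (pRoot-uniform λ' L v))
    (p≤c*q⇒p/q≤c (ζ-pos λ' 0<λ L v O) (below O))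

  above⇒hi≤pRoot : ∀ L v → Above L v → hi O ≤ pRoot λ' L (T-DG L) (uniform v L (T-DG L))
  above⇒hi≤pRoot L v above = subst (hi O ≤_) (sym (pRoot-uniform λ' L v))
    (c*q≤p⇒c≤p/q (ζ-pos λ' 0<λ L v O) (above O))

  root-gap : ∀ L → hi O - lo O ≤ ∣ pRoot λ' L (T-DG L) (uniform true  L (T-DG L))
                                 - pRoot λ' L (T-DG L) (uniform false L (T-DG L)) ∣
  root-gap L with oscillation L
  ... | inj₁ (below , above) =
    subst (hi O - lo O ≤_) (∣p-q∣≡∣q-p∣ (pRoot λ' L (T-DG L) (uniform false L (T-DG L)))
                                         (pRoot λ' L (T-DG L) (uniform true  L (T-DG L))))
          (separated⇒gap≤∣-∣ (below⇒pRoot≤lo L true below) (above⇒hi≤pRoot L false above))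
  ... | inj₂ (above , below) =
    separated⇒gap≤∣-∣ (below⇒pRoot≤lo L false below) (above⇒hi≤pRoot L true above)

  ¬WSM : lo O < hi O → ¬ WSM-DG λ'
  ¬WSM lo<hi (γ , 0<γ , γ<1 , wsm) = <-irrefl refl (≤-<-trans {gap} gap≤γᴸ γᴸ<gap)
    where
      gap = hi O - lo O
      eventually = ^ℚ-eventually-< (<⇒≤ 0<γ) γ<1 (p<q⇒0<q-p lo<hi)
      L = proj₁ eventually
      γᴸ<gap : γ ^ℚ L < gap
      γᴸ<gap = proj₂ eventually
      gap≤γᴸ : gap ≤ γ ^ℚ L
      gap≤γᴸ = ≤-trans {gap} (root-gap L) (wsm L (uniform true L (T-DG L)) (uniform false L (T-DG L)))

-- One pair of bounds per isomorphism type of subtree: {O, N, NN} (three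
-- children), {EN, WN}, and the states whose last step is horizontal.
lo₀ hi₀ : State → ℚ
lo₀ O  = + 5587 / 10000
lo₀ N  = + 5587 / 10000
lo₀ NN = + 5587 / 10000
lo₀ EN = + 531 / 1250
lo₀ WN = + 531 / 1250
lo₀ _  = + 989 / 2000
hi₀ O  = + 1707 / 2500
hi₀ N  = + 1707 / 2500
hi₀ NN = + 1707 / 2500
hi₀ EN = + 1289 / 2500
hi₀ WN = + 1289 / 2500
hi₀ _  = + 5833 / 10000

certified : ∀ s →
  T (0ℚ ≤ᵇ lo₀ s) × T (0ℚ ≤ᵇ hi₀ s) ×
  T (hi₀ s * (1ℚ + (+ 17 / 5) * ∏ (map lo₀ (children s))) ≤ᵇ 1ℚ) ×
  T (1ℚ ≤ᵇ lo₀ s * (1ℚ + (+ 17 / 5) * ∏ (map hi₀ (children s))))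
certified O  = _
certified N  = _
certified E  = _
certified W  = _
certified NN = _
certified NE = _
certified NW = _
certified WW = _
certified EE = _
certified WN = _
certified EN = _

certificate : Certificate (+ 17 / 5)
certificate = record
  { lo        = lo₀
  ; hi        = hi₀
  ; lo-nonNeg = λ s → ≤ᵇ⇒≤ (proj₁ (certified s))
  ; hi-nonNeg = λ s → ≤ᵇ⇒≤ (proj₁ (proj₂ (certified s)))
  ; hi-step   = λ s → ≤ᵇ⇒≤ (proj₁ (proj₂ (proj₂ (certified s))))
  ; lo-step   = λ s → ≤ᵇ⇒≤ (proj₂ (proj₂ (proj₂ (certified s))))
  }

lemma6 : ¬ WSM-DG ((+ 17) / 5)
lemma6 = Oscillation.¬WSM (positive⁻¹ _) certificate (toWitness {a? = lo₀ O <? hi₀ O} tt)
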